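{- $\alpha(11,2)=931$. More precisely, there exists an independent set of cardinality $931$ in the simple graph underlying $B(11,2)$ that contains the word $0^{11}$ and does not contain the word $1^{11}$.
   Context: The de Bruijn digraph $B(k,2)$ has vertex set $\{0,1\}^k$ and edges $x_1\dots x_k\to x_2\dots x_k y$, $y\in\{0,1\}$. In its underlying simple graph (loops deleted), distinct words $x_1\dots x_k$, $y_1\dots y_k$ are adjacent iff $x_2\dots x_k=y_1\dots y_{k-1}$ or $y_2\dots y_k=x_1\dots x_{k-1}$. $\alpha(k,2)$ is the independence number of this simple graph. -}

module Defs where

open import Data.Nat using (ℕ; suc)
open import Data.Bool using (Bool; true; false)
open import Data.Vec using (Vec; tail; init; replicate)
open import Data.List using (List)
open import Data.List.Membership.Propositional using (_∈_)
open import Data.List.Relation.Unary.Unique.Propositional using (Unique)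
open import Data.Product using (_×_)
open import Data.Sum using (_⊎_)
open import Relation.Binary.PropositionalEquality using (_≡_; _≢_)
open import Relation.Nullary using (¬_)

-- Binary words of length k = suc n (k ≥ 1): vertices of B(k,2).
Word : ℕ → Set
Word n = Vec Bool (suc n)

-- Adjacency in the simple graph underlying the de Bruijn digraph B(suc n, 2):
-- distinct words x, y with x₂…x_k = y₁…y_{k-1} or y₂…y_k = x₁…x_{k-1}.
Adjacent : ∀ {n} → Word n → Word n → Set
Adjacent x y = x ≢ y × (tail x ≡ init y ⊎ tail y ≡ init x)

IsIndependent : ∀ {n} → List (Word n) → Set
IsIndependent {n} S =
  Unique S × (∀ {x y : Word n} → x ∈ S → y ∈ S → ¬ Adjacent x y)

-- the constant words 0^k and 1^k (0 = false, 1 = true)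
zeros : ∀ n → Word n
zeros n = replicate (suc n) false

ones : ∀ n → Word n
ones n = replicate (suc n) true

module Submission where

-- Lower bound: the 931 words listed below are pairwise distinct, and every
-- successor x₂…x₁₁b of a listed word x is x itself or unlisted.  Since an edge
-- x – y of the simple graph makes y a successor of x or x a successor of y,
-- the list is independent.
--
-- Upper bound: an independent set S meets a closed walk of length m in at most
-- ⌊m/2⌋ positions, because every vertex of S on the walk is followed by one
-- outside S.  Rotation x ↦ x₂…x₁₁x₁ is an arc, so each of the 186 rotation
-- classes (necklaces) of non-constant words is an 11-cycle meeting S at most 5
-- times.  176 of them are used as they are; the other ten and the two constant
-- words are covered by 27 shorter closed walks whose bounds add up to 51 rather
-- than 5·10 + 2.  Hence |S| ≤ 176·5 + 51 = 931.

open import Defs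
open import Data.Bool using (Bool; true; false; T; _∧_)
import Data.Bool as Bool
import Data.Bool.Properties as Bool
open import Data.Empty using (⊥-elim)
open import Data.List using (List; []; _∷_; _++_; [_]; length; filter; map; concat; take; iterate)
open import Data.List.Membership.Propositional using (_∈_; _∉_)
open import Data.List.Membership.Propositional.Properties using (∈-∃++; ∈-++⁺ˡ; ∈-++⁺ʳ; ∈-++⁻; ∈-filter⁺)
import Data.List.Membership.DecPropositional as DecMembership
open import Data.List.Properties using (length-++; filter-++)
open import Data.List.Relation.Binary.Subset.Propositional using (_⊆_)
open import Data.List.Relation.Unary.All using (All; []; _∷_; all?)
import Data.List.Relation.Unary.All as All
open import Data.List.Relation.Unary.AllPairs using ([]; _∷_)
open import Data.List.Relation.Unary.Any using (here; there)
open import Data.List.Relation.Unary.Linked using (Linked; _∷_; linked?)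
open import Data.List.Relation.Unary.Unique.Propositional using (Unique)
open import Data.Nat using (ℕ; zero; suc; _+_; _≤_; z≤n; s≤s; ⌊_/2⌋; _/_; _%_; _≡ᵇ_)
open import Data.Nat.ListAction using (sum)
open import Data.Nat.Properties
  using (+-comm; +-suc; +-mono-≤; +-monoʳ-≤; ⌊n/2⌋-mono; n≡⌊n+n/2⌋; ≤-refl; ≤-reflexive; ≤-trans; module ≤-Reasoning)
open import Data.Product using (Σ; _×_; _,_; proj₁; proj₂)
open import Data.Sum using (_⊎_; inj₁; inj₂; [_,_]′; map₁)
open import Data.Unit using (⊤; tt)
open import Data.Vec using (Vec; []; _∷_; head; tail; init; last; _∷ʳ_; initLast)
open import Data.Vec.Properties using (≡-dec)
open import Function using (_∘_; id; Equivalence)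
open import Level using (_⊔_)
open import Relation.Binary using (Rel; DecidableEquality)
import Relation.Binary as Binary
open import Relation.Binary.PropositionalEquality using (_≡_; _≢_; refl; sym; trans; cong; subst)
open import Relation.Nullary using (¬_; Dec; yes; no; ¬?; _×-dec_; _⊎-dec_; contradiction)
open import Relation.Nullary.Decidable using (from-yes; from-no)
open import Relation.Unary using (Pred; Decidable)
open import Relation.Unary.Properties using (∁?)

count : ∀ {a p} {A : Set a} {P : Pred A p} → Decidable P → List A → ℕ
count P? xs = length (filter P? xs)

module _ {a p} {A : Set a} {P : Pred A p} (P? : Decidable P) where

  count-++ : ∀ xs ys → count P? (xs ++ ys) ≡ count P? xs + count P? ys
  count-++ xs ys = trans (cong length (filter-++ P? xs ys)) (length-++ (filter P? xs))

  count-rotate : ∀ x xs → count P? (xs ++ [ x ]) ≡ count P? (x ∷ xs)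
  count-rotate x xs =
    trans (count-++ xs [ x ]) (trans (+-comm (count P? xs) _) (sym (count-++ [ x ] xs)))

  count+count-∁ : ∀ xs → count P? xs + count (∁? P?) xs ≡ length xs
  count+count-∁ []       = refl
  count+count-∁ (x ∷ xs) with P? x
  ... | yes _ = cong suc (count+count-∁ xs)
  ... | no _  = trans (+-suc (count P? xs) _) (cong suc (count+count-∁ xs))

ClosedWalk : ∀ {a r} {A : Set a} → Rel A r → List A → Set (a ⊔ r)
ClosedWalk R xs = Linked R (xs ++ take 1 xs)

closedWalk? : ∀ {a r} {A : Set a} {R : Rel A r} → Binary.Decidable R → Decidable (ClosedWalk R)
closedWalk? R? xs = linked? R? (xs ++ take 1 xs)

module _ {a p r} {A : Set a} {R : Rel A r} {P : Pred A p} (P? : Decidable P)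
         (P-independent : ∀ {x y} → P x → P y → ¬ R x y) where

  open ≤-Reasoning

  count-edge : ∀ {x y} → R x y → count P? [ x ] ≤ count (∁? P?) [ y ]
  count-edge {x} {y} xRy with P? x | P? y
  ... | yes Px | yes Py = contradiction xRy (P-independent Px Py)
  ... | yes _  | no _   = ≤-refl
  ... | no _   | _      = z≤n

  count-walk : ∀ x xs y → Linked R (x ∷ xs ++ [ y ]) →
               count P? (x ∷ xs) ≤ count (∁? P?) (xs ++ [ y ])
  count-walk x []       y (xRy ∷ _)    = count-edge xRy
  count-walk x (z ∷ zs) y (xRz ∷ walk) = begin
    count P? (x ∷ z ∷ zs)                              ≡⟨ count-++ P? [ x ] (z ∷ zs) ⟩
    count P? [ x ] + count P? (z ∷ zs)                 ≤⟨ +-mono-≤ (count-edge xRz) (count-walk z zs y walk) ⟩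
    count (∁? P?) [ z ] + count (∁? P?) (zs ++ [ y ])  ≡⟨ count-++ (∁? P?) [ z ] (zs ++ [ y ]) ⟨
    count (∁? P?) (z ∷ zs ++ [ y ])                    ∎

  count-closedWalk : ∀ xs → ClosedWalk R xs → count P? xs ≤ ⌊ length xs /2⌋
  count-closedWalk []           _    = z≤n
  count-closedWalk xs@(x ∷ ys) walk = begin
    count P? xs                       ≡⟨ n≡⌊n+n/2⌋ (count P? xs) ⟩
    ⌊ count P? xs + count P? xs /2⌋   ≤⟨ ⌊n/2⌋-mono twice≤length ⟩
    ⌊ length xs /2⌋                   ∎
    where
    twice≤length : count P? xs + count P? xs ≤ length xs
    twice≤length = begin
      count P? xs + count P? xs                  ≤⟨ +-monoʳ-≤ (count P? xs) (count-walk x ys x walk) ⟩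
      count P? xs + count (∁? P?) (ys ++ [ x ])  ≡⟨ cong (count P? xs +_) (count-rotate (∁? P?) x ys) ⟩
      count P? xs + count (∁? P?) xs             ≡⟨ count+count-∁ P? xs ⟩
      length xs                                  ∎

  count-closedWalks : ∀ {walks} → All (ClosedWalk R) walks →
                      count P? (concat walks) ≤ sum (map (⌊_/2⌋ ∘ length) walks)
  count-closedWalks {[]}         []              = z≤n
  count-closedWalks {xs ∷ walks} (walk ∷ closed) = begin
    count P? (xs ++ concat walks)                        ≡⟨ count-++ P? xs (concat walks) ⟩
    count P? xs + count P? (concat walks)                ≤⟨ +-mono-≤ (count-closedWalk xs walk) (count-closedWalks closed) ⟩
    ⌊ length xs /2⌋ + sum (map (⌊_/2⌋ ∘ length) walks)  ∎

unique-⊆⇒length-≤ : ∀ {a} {A : Set a} {xs ys : List A} → Unique xs → xs ⊆ ys → length xs ≤ length ys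
unique-⊆⇒length-≤ {xs = []}     _               _     = z≤n
unique-⊆⇒length-≤ {xs = x ∷ xs} (x∉xs ∷ unique) xs⊆ys
  with us , vs , refl ← ∈-∃++ (xs⊆ys (here refl)) = begin
    suc (length xs)              ≤⟨ s≤s (unique-⊆⇒length-≤ unique xs⊆us++vs) ⟩
    suc (length (us ++ vs))      ≡⟨ cong suc (length-++ us) ⟩
    suc (length us + length vs)  ≡⟨ +-suc (length us) (length vs) ⟨
    length us + length (x ∷ vs)  ≡⟨ length-++ us ⟨
    length (us ++ x ∷ vs)        ∎
  where
  open ≤-Reasoning
  xs⊆us++vs : xs ⊆ us ++ vs
  xs⊆us++vs {y} y∈xs with ∈-++⁻ us (xs⊆ys (there y∈xs))
  ... | inj₁ y∈us         = ∈-++⁺ˡ y∈us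
  ... | inj₂ (here refl)  = contradiction refl (All.lookup x∉xs y∈xs)
  ... | inj₂ (there y∈vs) = ∈-++⁺ʳ us y∈vs

independent-≤-closedWalkCover :
  ∀ {a r} {A : Set a} {R : Rel A r} → DecidableEquality A →
  ∀ {S : List A} walks → Unique S → (∀ {x y} → x ∈ S → y ∈ S → ¬ R x y) →
  All (ClosedWalk R) walks → S ⊆ concat walks → length S ≤ sum (map (⌊_/2⌋ ∘ length) walks)
independent-≤-closedWalkCover _≟_ {S} walks unique independent closed covered = begin
  length S                          ≤⟨ unique-⊆⇒length-≤ unique (λ x∈S → ∈-filter⁺ (_∈? S) (covered x∈S) x∈S) ⟩
  count (_∈? S) (concat walks)      ≤⟨ count-closedWalks (_∈? S) independent closed ⟩
  sum (map (⌊_/2⌋ ∘ length) walks)  ∎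
  where
  open ≤-Reasoning
  open DecMembership _≟_ using (_∈?_)

-- Finite sets of bit vectors, so that membership in the long lists below is
-- decided in time linear in the word length.
data Trie : ℕ → Set where
  leaf : Bool → Trie zero
  node : ∀ {k} → Trie k → Trie k → Trie (suc k)

empty : ∀ k → Trie k
empty zero    = leaf false
empty (suc k) = node (empty k) (empty k)

member : ∀ {k} → Vec Bool k → Trie k → Bool
member []           (leaf b)   = b
member (false ∷ xs) (node l r) = member xs l
member (true ∷ xs)  (node l r) = member xs r

insert : ∀ {k} → Vec Bool k → Trie k → Trie k
insert []           (leaf _)   = leaf true
insert (false ∷ xs) (node l r) = node (insert xs l) r
insert (true ∷ xs)  (node l r) = node l (insert xs r)

fromList : ∀ {k} → List (Vec Bool k) → Trie k
fromList {k} []       = empty k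
fromList     (x ∷ xs) = insert x (fromList xs)

isFull : ∀ {k} → Trie k → Bool
isFull (leaf b)   = b
isFull (node l r) = isFull l ∧ isFull r

member-empty : ∀ {k} (y : Vec Bool k) → ¬ T (member y (empty k))
member-empty (false ∷ y) = member-empty y
member-empty (true ∷ y)  = member-empty y

member-insert-self : ∀ {k} (x : Vec Bool k) t → T (member x (insert x t))
member-insert-self []           (leaf _)   = tt
member-insert-self (false ∷ xs) (node l r) = member-insert-self xs l
member-insert-self (true ∷ xs)  (node l r) = member-insert-self xs r

member-insert-mono : ∀ {k} (x y : Vec Bool k) t → T (member y t) → T (member y (insert x t))
member-insert-mono []           []           (leaf _)   _ = tt
member-insert-mono (false ∷ xs) (false ∷ ys) (node l r)   = member-insert-mono xs ys l
member-insert-mono (false ∷ xs) (true ∷ ys)  (node l r)   = id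
member-insert-mono (true ∷ xs)  (false ∷ ys) (node l r)   = id
member-insert-mono (true ∷ xs)  (true ∷ ys)  (node l r)   = member-insert-mono xs ys r

member-insert⁻ : ∀ {k} (x y : Vec Bool k) t → T (member y (insert x t)) → x ≡ y ⊎ T (member y t)
member-insert⁻ []           []           (leaf _)   _  = inj₁ refl
member-insert⁻ (false ∷ xs) (false ∷ ys) (node l r) y∈ = map₁ (cong (false ∷_)) (member-insert⁻ xs ys l y∈)
member-insert⁻ (false ∷ xs) (true ∷ ys)  (node l r) y∈ = inj₂ y∈
member-insert⁻ (true ∷ xs)  (false ∷ ys) (node l r) y∈ = inj₂ y∈
member-insert⁻ (true ∷ xs)  (true ∷ ys)  (node l r) y∈ = map₁ (cong (true ∷_)) (member-insert⁻ xs ys r y∈)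

member-fromList⁺ : ∀ {k} {y : Vec Bool k} {xs} → y ∈ xs → T (member y (fromList xs))
member-fromList⁺ {xs = x ∷ xs}     (here refl)  = member-insert-self x (fromList xs)
member-fromList⁺ {y = y} {x ∷ xs} (there y∈xs) = member-insert-mono x y (fromList xs) (member-fromList⁺ y∈xs)

member-fromList⁻ : ∀ {k} {y : Vec Bool k} xs → T (member y (fromList xs)) → y ∈ xs
member-fromList⁻ {y = y} []       y∈ = ⊥-elim (member-empty y y∈)
member-fromList⁻ {y = y} (x ∷ xs) y∈ with member-insert⁻ x y (fromList xs) y∈
... | inj₁ refl = here refl
... | inj₂ y∈′  = there (member-fromList⁻ xs y∈′)

isFull⇒member : ∀ {k} (t : Trie k) → T (isFull t) → ∀ y → T (member y t)
isFull⇒member (leaf _)   full []          = full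
isFull⇒member (node l r) full (false ∷ y) = isFull⇒member l (proj₁ (Equivalence.to Bool.T-∧ full)) y
isFull⇒member (node l r) full (true ∷ y)  = isFull⇒member r (proj₂ (Equivalence.to (Bool.T-∧ {isFull l}) full)) y

fromList-isFull⇒complete : ∀ {k} (xs : List (Vec Bool k)) → T (isFull (fromList xs)) → ∀ y → y ∈ xs
fromList-isFull⇒complete xs full y = member-fromList⁻ xs (isFull⇒member (fromList xs) full y)

AllNew : ∀ {k} → Trie k → List (Vec Bool k) → Set
AllNew seen []       = ⊤
AllNew seen (x ∷ xs) = ¬ T (member x seen) × AllNew (insert x seen) xs

allNew? : ∀ {k} (seen : Trie k) xs → Dec (AllNew seen xs)
allNew? seen []       = yes tt
allNew? seen (x ∷ xs) = ¬? (Bool.T? (member x seen)) ×-dec allNew? (insert x seen) xs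

allNew⇒∉ : ∀ {k} {seen : Trie k} xs → AllNew seen xs → All (λ y → ¬ T (member y seen)) xs
allNew⇒∉ []                      _           = []
allNew⇒∉ {seen = seen} (x ∷ xs) (x∉ , new) =
  x∉ ∷ All.map (λ {y} y∉ → y∉ ∘ member-insert-mono x y seen) (allNew⇒∉ xs new)

allNew⇒unique : ∀ {k} (seen : Trie k) xs → AllNew seen xs → Unique xs
allNew⇒unique seen []       _         = []
allNew⇒unique seen (x ∷ xs) (_ , new) =
  All.map (λ y∉ x≡y → y∉ (subst (λ y → T (member y (insert x seen))) x≡y (member-insert-self x seen)))
          (allNew⇒∉ xs new)
  ∷ allNew⇒unique (insert x seen) xs new

_≟_ : ∀ {k} → DecidableEquality (Vec Bool k)
_≟_ = ≡-dec Bool._≟_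

adjacent? : ∀ {n} → Binary.Decidable (Adjacent {n})
adjacent? x y = ¬? (x ≟ y) ×-dec (tail x ≟ init y ⊎-dec tail y ≟ init x)

successor : ∀ {n} → Word n → Bool → Word n
successor x b = tail x ∷ʳ b

tail≡init⇒successor : ∀ {n} {x y : Word n} → tail x ≡ init y → y ≡ successor x (last y)
tail≡init⇒successor {y = y} tail≡init =
  trans (proj₂ (proj₂ (initLast y))) (cong (_∷ʳ last y) (sym tail≡init))

independent-if-successors-loop :
  ∀ {n} {S : List (Word n)} → Unique S →
  (∀ {x} b → x ∈ S → successor x b ∈ S → successor x b ≡ x) → IsIndependent S
independent-if-successors-loop {S = S} unique loop = unique , λ x∈S y∈S (x≢y , arc) →
  [ no-arc x∈S y∈S x≢y , no-arc y∈S x∈S (x≢y ∘ sym) ]′ arc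
  where
  no-arc : ∀ {x y} → x ∈ S → y ∈ S → x ≢ y → tail x ≢ init y
  no-arc {x} {y} x∈S y∈S x≢y tail≡init =
    x≢y (sym (trans y≡successor (loop (last y) x∈S (subst (_∈ S) y≡successor y∈S))))
    where
    y≡successor : y ≡ successor x (last y)
    y≡successor = tail≡init⇒successor {x = x} tail≡init

LoopOrOutside : ∀ {n} → Trie (suc n) → Word n → Bool → Set
LoopOrOutside t x b = successor x b ≡ x ⊎ ¬ T (member (successor x b) t)

SuccessorsLoopOrOutside : ∀ {n} → Trie (suc n) → Word n → Set
SuccessorsLoopOrOutside t x = LoopOrOutside t x false × LoopOrOutside t x true

successorsLoopOrOutside? : ∀ {n} (t : Trie (suc n)) x → Dec (SuccessorsLoopOrOutside t x)
successorsLoopOrOutside? t x = loopOrOutside? false ×-dec loopOrOutside? true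
  where
  loopOrOutside? : ∀ b → Dec (LoopOrOutside t x b)
  loopOrOutside? b = (successor x b ≟ x) ⊎-dec ¬? (Bool.T? (member (successor x b) t))

successorsLoopOrOutside⇒loop :
  ∀ {n} {S : List (Word n)} → All (SuccessorsLoopOrOutside (fromList S)) S →
  ∀ {x} b → x ∈ S → successor x b ∈ S → successor x b ≡ x
successorsLoopOrOutside⇒loop certificate b x∈S y∈S with All.lookup certificate x∈S | b
... | loopOrOutside , _ | false = [ id , contradiction (member-fromList⁺ y∈S) ]′ loopOrOutside
... | _ , loopOrOutside | true  = [ id , contradiction (member-fromList⁺ y∈S) ]′ loopOrOutside

rotate : ∀ {n} → Word n → Word n
rotate x = successor x (head x)

necklace : ∀ {n} → Word n → List (Word n)
necklace {n} x = iterate rotate x (suc n)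

fromBinary : ∀ k → ℕ → Vec Bool k
fromBinary zero    _ = []
fromBinary (suc k) m = fromBinary k (m / 2) ∷ʳ (m % 2 ≡ᵇ 1)

-- The word whose bits are the 11-digit binary expansion of m, most significant first.
word : ℕ → Word 10
word = fromBinary 11

independentSet : List (Word 10)
independentSet = map word (
  0 ∷ 2 ∷ 3 ∷ 8 ∷ 9 ∷ 10 ∷ 11 ∷ 12 ∷ 13 ∷ 14 ∷ 15 ∷ 32 ∷ 33 ∷ 34 ∷ 35 ∷ 36 ∷
  37 ∷ 38 ∷ 39 ∷ 40 ∷ 41 ∷ 42 ∷ 43 ∷ 44 ∷ 45 ∷ 46 ∷ 47 ∷ 48 ∷ 49 ∷ 50 ∷ 51 ∷
  52 ∷ 53 ∷ 54 ∷ 55 ∷ 56 ∷ 57 ∷ 58 ∷ 59 ∷ 60 ∷ 61 ∷ 62 ∷ 63 ∷ 128 ∷ 130 ∷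
  131 ∷ 136 ∷ 137 ∷ 138 ∷ 139 ∷ 140 ∷ 141 ∷ 142 ∷ 143 ∷ 146 ∷ 147 ∷ 152 ∷
  155 ∷ 160 ∷ 162 ∷ 163 ∷ 164 ∷ 165 ∷ 166 ∷ 167 ∷ 168 ∷ 169 ∷ 170 ∷ 171 ∷
  172 ∷ 173 ∷ 174 ∷ 175 ∷ 176 ∷ 178 ∷ 179 ∷ 180 ∷ 181 ∷ 182 ∷ 183 ∷ 184 ∷
  185 ∷ 186 ∷ 187 ∷ 188 ∷ 189 ∷ 190 ∷ 191 ∷ 194 ∷ 195 ∷ 200 ∷ 201 ∷ 202 ∷
  203 ∷ 204 ∷ 205 ∷ 206 ∷ 207 ∷ 208 ∷ 210 ∷ 211 ∷ 212 ∷ 213 ∷ 214 ∷ 215 ∷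
  216 ∷ 219 ∷ 224 ∷ 226 ∷ 227 ∷ 228 ∷ 229 ∷ 230 ∷ 231 ∷ 232 ∷ 233 ∷ 234 ∷
  235 ∷ 236 ∷ 237 ∷ 238 ∷ 239 ∷ 240 ∷ 242 ∷ 243 ∷ 244 ∷ 245 ∷ 246 ∷ 247 ∷
  248 ∷ 249 ∷ 250 ∷ 251 ∷ 252 ∷ 253 ∷ 254 ∷ 255 ∷ 258 ∷ 259 ∷ 264 ∷ 265 ∷
  266 ∷ 267 ∷ 268 ∷ 269 ∷ 270 ∷ 271 ∷ 288 ∷ 290 ∷ 291 ∷ 296 ∷ 297 ∷ 298 ∷
  299 ∷ 300 ∷ 301 ∷ 302 ∷ 303 ∷ 306 ∷ 307 ∷ 308 ∷ 309 ∷ 312 ∷ 313 ∷ 314 ∷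
  315 ∷ 316 ∷ 317 ∷ 318 ∷ 319 ∷ 322 ∷ 323 ∷ 354 ∷ 355 ∷ 384 ∷ 386 ∷ 387 ∷
  392 ∷ 393 ∷ 394 ∷ 395 ∷ 396 ∷ 397 ∷ 398 ∷ 399 ∷ 418 ∷ 419 ∷ 434 ∷ 435 ∷
  436 ∷ 437 ∷ 440 ∷ 441 ∷ 442 ∷ 443 ∷ 444 ∷ 445 ∷ 446 ∷ 447 ∷ 450 ∷ 451 ∷
  482 ∷ 483 ∷ 512 ∷ 514 ∷ 515 ∷ 520 ∷ 521 ∷ 522 ∷ 523 ∷ 524 ∷ 525 ∷ 526 ∷
  527 ∷ 544 ∷ 546 ∷ 547 ∷ 548 ∷ 550 ∷ 552 ∷ 553 ∷ 554 ∷ 555 ∷ 556 ∷ 557 ∷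
  558 ∷ 559 ∷ 560 ∷ 562 ∷ 563 ∷ 564 ∷ 565 ∷ 566 ∷ 568 ∷ 569 ∷ 570 ∷ 571 ∷
  572 ∷ 573 ∷ 574 ∷ 575 ∷ 578 ∷ 579 ∷ 584 ∷ 586 ∷ 587 ∷ 588 ∷ 589 ∷ 590 ∷
  591 ∷ 608 ∷ 610 ∷ 611 ∷ 620 ∷ 621 ∷ 622 ∷ 623 ∷ 640 ∷ 642 ∷ 643 ∷ 648 ∷
  649 ∷ 650 ∷ 651 ∷ 652 ∷ 653 ∷ 654 ∷ 655 ∷ 658 ∷ 659 ∷ 664 ∷ 667 ∷ 672 ∷
  674 ∷ 675 ∷ 678 ∷ 680 ∷ 681 ∷ 682 ∷ 683 ∷ 684 ∷ 685 ∷ 686 ∷ 687 ∷ 690 ∷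
  691 ∷ 692 ∷ 693 ∷ 694 ∷ 695 ∷ 696 ∷ 697 ∷ 698 ∷ 699 ∷ 700 ∷ 701 ∷ 702 ∷
  703 ∷ 706 ∷ 707 ∷ 712 ∷ 713 ∷ 714 ∷ 715 ∷ 716 ∷ 717 ∷ 718 ∷ 719 ∷ 720 ∷
  722 ∷ 723 ∷ 724 ∷ 726 ∷ 727 ∷ 728 ∷ 731 ∷ 736 ∷ 738 ∷ 739 ∷ 740 ∷ 742 ∷
  744 ∷ 745 ∷ 746 ∷ 747 ∷ 748 ∷ 749 ∷ 750 ∷ 751 ∷ 752 ∷ 754 ∷ 755 ∷ 756 ∷
  757 ∷ 758 ∷ 759 ∷ 760 ∷ 762 ∷ 763 ∷ 764 ∷ 766 ∷ 767 ∷ 770 ∷ 771 ∷ 776 ∷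
  777 ∷ 778 ∷ 779 ∷ 780 ∷ 781 ∷ 782 ∷ 783 ∷ 800 ∷ 802 ∷ 803 ∷ 804 ∷ 808 ∷
  809 ∷ 810 ∷ 811 ∷ 812 ∷ 813 ∷ 814 ∷ 815 ∷ 818 ∷ 819 ∷ 820 ∷ 821 ∷ 824 ∷
  825 ∷ 826 ∷ 827 ∷ 828 ∷ 829 ∷ 830 ∷ 831 ∷ 834 ∷ 835 ∷ 840 ∷ 842 ∷ 843 ∷
  844 ∷ 845 ∷ 846 ∷ 847 ∷ 848 ∷ 850 ∷ 851 ∷ 856 ∷ 864 ∷ 866 ∷ 867 ∷ 876 ∷
  877 ∷ 878 ∷ 879 ∷ 896 ∷ 898 ∷ 899 ∷ 904 ∷ 905 ∷ 906 ∷ 907 ∷ 908 ∷ 909 ∷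
  910 ∷ 911 ∷ 915 ∷ 920 ∷ 923 ∷ 928 ∷ 930 ∷ 931 ∷ 932 ∷ 938 ∷ 939 ∷ 940 ∷
  941 ∷ 942 ∷ 943 ∷ 946 ∷ 947 ∷ 948 ∷ 949 ∷ 952 ∷ 953 ∷ 954 ∷ 955 ∷ 956 ∷
  957 ∷ 958 ∷ 959 ∷ 962 ∷ 963 ∷ 968 ∷ 969 ∷ 970 ∷ 971 ∷ 972 ∷ 973 ∷ 974 ∷
  975 ∷ 979 ∷ 980 ∷ 984 ∷ 987 ∷ 992 ∷ 994 ∷ 995 ∷ 1000 ∷ 1001 ∷ 1002 ∷ 1003 ∷
  1004 ∷ 1005 ∷ 1006 ∷ 1007 ∷ 1010 ∷ 1011 ∷ 1016 ∷ 1018 ∷ 1019 ∷ 1022 ∷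
  1023 ∷ 1026 ∷ 1027 ∷ 1032 ∷ 1033 ∷ 1034 ∷ 1035 ∷ 1036 ∷ 1037 ∷ 1038 ∷
  1039 ∷ 1056 ∷ 1057 ∷ 1058 ∷ 1059 ∷ 1060 ∷ 1061 ∷ 1062 ∷ 1063 ∷ 1064 ∷
  1065 ∷ 1066 ∷ 1067 ∷ 1068 ∷ 1069 ∷ 1070 ∷ 1071 ∷ 1072 ∷ 1073 ∷ 1074 ∷
  1075 ∷ 1076 ∷ 1077 ∷ 1078 ∷ 1079 ∷ 1080 ∷ 1081 ∷ 1082 ∷ 1083 ∷ 1084 ∷
  1085 ∷ 1086 ∷ 1087 ∷ 1090 ∷ 1091 ∷ 1098 ∷ 1099 ∷ 1102 ∷ 1103 ∷ 1122 ∷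
  1123 ∷ 1134 ∷ 1135 ∷ 1152 ∷ 1154 ∷ 1155 ∷ 1160 ∷ 1161 ∷ 1162 ∷ 1163 ∷
  1164 ∷ 1165 ∷ 1166 ∷ 1167 ∷ 1170 ∷ 1171 ∷ 1184 ∷ 1186 ∷ 1187 ∷ 1188 ∷
  1189 ∷ 1190 ∷ 1191 ∷ 1192 ∷ 1193 ∷ 1194 ∷ 1195 ∷ 1196 ∷ 1197 ∷ 1198 ∷
  1199 ∷ 1200 ∷ 1202 ∷ 1203 ∷ 1204 ∷ 1205 ∷ 1206 ∷ 1207 ∷ 1208 ∷ 1209 ∷
  1210 ∷ 1211 ∷ 1212 ∷ 1213 ∷ 1214 ∷ 1215 ∷ 1218 ∷ 1219 ∷ 1224 ∷ 1225 ∷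
  1226 ∷ 1227 ∷ 1228 ∷ 1229 ∷ 1230 ∷ 1231 ∷ 1232 ∷ 1234 ∷ 1235 ∷ 1236 ∷
  1237 ∷ 1238 ∷ 1239 ∷ 1248 ∷ 1250 ∷ 1251 ∷ 1252 ∷ 1253 ∷ 1254 ∷ 1255 ∷
  1256 ∷ 1257 ∷ 1258 ∷ 1259 ∷ 1260 ∷ 1261 ∷ 1262 ∷ 1263 ∷ 1264 ∷ 1266 ∷
  1267 ∷ 1268 ∷ 1269 ∷ 1270 ∷ 1271 ∷ 1272 ∷ 1273 ∷ 1274 ∷ 1275 ∷ 1276 ∷
  1277 ∷ 1278 ∷ 1279 ∷ 1282 ∷ 1283 ∷ 1288 ∷ 1289 ∷ 1290 ∷ 1291 ∷ 1292 ∷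
  1293 ∷ 1294 ∷ 1295 ∷ 1312 ∷ 1314 ∷ 1315 ∷ 1320 ∷ 1321 ∷ 1322 ∷ 1323 ∷
  1324 ∷ 1325 ∷ 1326 ∷ 1327 ∷ 1330 ∷ 1331 ∷ 1332 ∷ 1333 ∷ 1336 ∷ 1337 ∷
  1338 ∷ 1339 ∷ 1340 ∷ 1341 ∷ 1342 ∷ 1343 ∷ 1346 ∷ 1347 ∷ 1352 ∷ 1354 ∷
  1355 ∷ 1358 ∷ 1359 ∷ 1376 ∷ 1378 ∷ 1379 ∷ 1408 ∷ 1410 ∷ 1411 ∷ 1416 ∷
  1417 ∷ 1418 ∷ 1419 ∷ 1420 ∷ 1421 ∷ 1422 ∷ 1423 ∷ 1442 ∷ 1443 ∷ 1450 ∷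
  1451 ∷ 1458 ∷ 1459 ∷ 1460 ∷ 1461 ∷ 1464 ∷ 1465 ∷ 1466 ∷ 1467 ∷ 1468 ∷
  1469 ∷ 1470 ∷ 1471 ∷ 1474 ∷ 1475 ∷ 1482 ∷ 1483 ∷ 1486 ∷ 1487 ∷ 1506 ∷
  1507 ∷ 1522 ∷ 1523 ∷ 1530 ∷ 1531 ∷ 1536 ∷ 1538 ∷ 1539 ∷ 1544 ∷ 1545 ∷
  1546 ∷ 1547 ∷ 1548 ∷ 1549 ∷ 1550 ∷ 1551 ∷ 1568 ∷ 1570 ∷ 1571 ∷ 1572 ∷
  1574 ∷ 1576 ∷ 1577 ∷ 1578 ∷ 1579 ∷ 1580 ∷ 1581 ∷ 1582 ∷ 1583 ∷ 1584 ∷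
  1586 ∷ 1587 ∷ 1588 ∷ 1589 ∷ 1590 ∷ 1592 ∷ 1593 ∷ 1594 ∷ 1595 ∷ 1596 ∷
  1597 ∷ 1598 ∷ 1599 ∷ 1602 ∷ 1603 ∷ 1610 ∷ 1611 ∷ 1612 ∷ 1613 ∷ 1614 ∷
  1615 ∷ 1632 ∷ 1634 ∷ 1635 ∷ 1644 ∷ 1645 ∷ 1646 ∷ 1647 ∷ 1664 ∷ 1666 ∷
  1667 ∷ 1672 ∷ 1673 ∷ 1674 ∷ 1675 ∷ 1676 ∷ 1677 ∷ 1678 ∷ 1679 ∷ 1682 ∷
  1683 ∷ 1698 ∷ 1699 ∷ 1704 ∷ 1705 ∷ 1706 ∷ 1707 ∷ 1708 ∷ 1709 ∷ 1710 ∷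
  1711 ∷ 1714 ∷ 1715 ∷ 1716 ∷ 1717 ∷ 1718 ∷ 1719 ∷ 1720 ∷ 1721 ∷ 1722 ∷
  1723 ∷ 1724 ∷ 1725 ∷ 1726 ∷ 1727 ∷ 1730 ∷ 1731 ∷ 1736 ∷ 1737 ∷ 1738 ∷
  1739 ∷ 1740 ∷ 1741 ∷ 1742 ∷ 1743 ∷ 1744 ∷ 1746 ∷ 1747 ∷ 1748 ∷ 1750 ∷
  1751 ∷ 1760 ∷ 1762 ∷ 1763 ∷ 1764 ∷ 1766 ∷ 1768 ∷ 1769 ∷ 1770 ∷ 1771 ∷
  1772 ∷ 1773 ∷ 1774 ∷ 1775 ∷ 1776 ∷ 1778 ∷ 1779 ∷ 1780 ∷ 1781 ∷ 1782 ∷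
  1783 ∷ 1784 ∷ 1786 ∷ 1787 ∷ 1788 ∷ 1790 ∷ 1791 ∷ 1794 ∷ 1795 ∷ 1800 ∷
  1801 ∷ 1802 ∷ 1803 ∷ 1804 ∷ 1805 ∷ 1806 ∷ 1807 ∷ 1824 ∷ 1826 ∷ 1827 ∷
  1828 ∷ 1832 ∷ 1833 ∷ 1834 ∷ 1835 ∷ 1836 ∷ 1837 ∷ 1838 ∷ 1839 ∷ 1842 ∷
  1843 ∷ 1844 ∷ 1845 ∷ 1848 ∷ 1849 ∷ 1850 ∷ 1851 ∷ 1852 ∷ 1853 ∷ 1854 ∷
  1855 ∷ 1858 ∷ 1859 ∷ 1866 ∷ 1867 ∷ 1868 ∷ 1869 ∷ 1870 ∷ 1871 ∷ 1872 ∷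
  1874 ∷ 1875 ∷ 1888 ∷ 1890 ∷ 1891 ∷ 1900 ∷ 1901 ∷ 1902 ∷ 1903 ∷ 1920 ∷
  1922 ∷ 1923 ∷ 1928 ∷ 1929 ∷ 1930 ∷ 1931 ∷ 1932 ∷ 1933 ∷ 1934 ∷ 1935 ∷
  1952 ∷ 1954 ∷ 1955 ∷ 1956 ∷ 1962 ∷ 1963 ∷ 1964 ∷ 1965 ∷ 1966 ∷ 1967 ∷
  1970 ∷ 1971 ∷ 1972 ∷ 1973 ∷ 1976 ∷ 1977 ∷ 1978 ∷ 1979 ∷ 1980 ∷ 1981 ∷
  1982 ∷ 1983 ∷ 1986 ∷ 1987 ∷ 1992 ∷ 1993 ∷ 1994 ∷ 1995 ∷ 1996 ∷ 1997 ∷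
  1998 ∷ 1999 ∷ 2016 ∷ 2018 ∷ 2019 ∷ 2024 ∷ 2025 ∷ 2026 ∷ 2027 ∷ 2028 ∷
  2029 ∷ 2030 ∷ 2031 ∷ 2034 ∷ 2035 ∷ 2040 ∷ 2042 ∷ 2043 ∷ [])

-- Closed walks covering the constant words and the necklaces of 1, 5, 21, 85, 341,
-- 683, 687, 703, 767 and 1023.
shortWalks : List (List ℕ)
shortWalks =
  (0 ∷ 1 ∷ 1024 ∷ []) ∷
  (2047 ∷ 2046 ∷ 1023 ∷ []) ∷
  (512 ∷ 1280 ∷ []) ∷
  (256 ∷ 128 ∷ 64 ∷ 32 ∷ 16 ∷ 8 ∷ 4 ∷ 1026 ∷ 513 ∷ []) ∷
  (2 ∷ 5 ∷ []) ∷
  (1282 ∷ 517 ∷ 1034 ∷ 20 ∷ 40 ∷ 80 ∷ 160 ∷ 320 ∷ 641 ∷ []) ∷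
  (10 ∷ 21 ∷ []) ∷
  (640 ∷ 1344 ∷ []) ∷
  (1290 ∷ 533 ∷ 1066 ∷ 84 ∷ 168 ∷ 336 ∷ 673 ∷ 1346 ∷ 645 ∷ []) ∷
  (42 ∷ 85 ∷ []) ∷
  (672 ∷ 1360 ∷ []) ∷
  (765 ∷ 1406 ∷ 1727 ∷ 1887 ∷ 1967 ∷ 2007 ∷ 2027 ∷ 1013 ∷ 1530 ∷ []) ∷
  (1322 ∷ 597 ∷ 1194 ∷ 340 ∷ 681 ∷ 1362 ∷ 677 ∷ 1354 ∷ 661 ∷ []) ∷
  (680 ∷ 1364 ∷ []) ∷
  (170 ∷ 341 ∷ []) ∷
  (682 ∷ 1365 ∷ []) ∷
  (1402 ∷ 701 ∷ 1374 ∷ 1711 ∷ 1879 ∷ 1963 ∷ 981 ∷ 1514 ∷ 757 ∷ []) ∷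
  (1962 ∷ 2005 ∷ []) ∷
  (2026 ∷ 2037 ∷ []) ∷
  (1450 ∷ 725 ∷ 1386 ∷ 693 ∷ 1370 ∷ 685 ∷ 1366 ∷ 1707 ∷ 853 ∷ []) ∷
  (1706 ∷ 1877 ∷ []) ∷
  (683 ∷ 1367 ∷ []) ∷
  (687 ∷ 1375 ∷ []) ∷
  (703 ∷ 1407 ∷ []) ∷
  (2042 ∷ 2045 ∷ []) ∷
  (2015 ∷ 1983 ∷ 1919 ∷ 1791 ∷ 1534 ∷ 1021 ∷ 2043 ∷ 2039 ∷ 2031 ∷ []) ∷
  (1535 ∷ 767 ∷ []) ∷
  []

-- One word from each of the remaining 176 necklaces.
necklaceRepresentatives : List ℕ
necklaceRepresentatives =
  3 ∷ 7 ∷ 9 ∷ 11 ∷ 13 ∷ 15 ∷ 17 ∷ 19 ∷ 23 ∷ 25 ∷ 27 ∷ 29 ∷ 31 ∷ 33 ∷ 35 ∷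
  37 ∷ 39 ∷ 41 ∷ 43 ∷ 45 ∷ 47 ∷ 49 ∷ 51 ∷ 53 ∷ 55 ∷ 57 ∷ 59 ∷ 61 ∷ 63 ∷ 67 ∷
  69 ∷ 71 ∷ 73 ∷ 75 ∷ 77 ∷ 79 ∷ 81 ∷ 83 ∷ 87 ∷ 89 ∷ 91 ∷ 93 ∷ 95 ∷ 99 ∷ 101 ∷
  103 ∷ 105 ∷ 107 ∷ 109 ∷ 111 ∷ 113 ∷ 115 ∷ 117 ∷ 119 ∷ 121 ∷ 123 ∷ 125 ∷
  127 ∷ 137 ∷ 139 ∷ 141 ∷ 143 ∷ 147 ∷ 149 ∷ 151 ∷ 153 ∷ 155 ∷ 157 ∷ 159 ∷
  163 ∷ 165 ∷ 167 ∷ 169 ∷ 171 ∷ 173 ∷ 175 ∷ 179 ∷ 181 ∷ 183 ∷ 185 ∷ 187 ∷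
  189 ∷ 191 ∷ 199 ∷ 201 ∷ 203 ∷ 205 ∷ 207 ∷ 211 ∷ 213 ∷ 215 ∷ 217 ∷ 219 ∷
  221 ∷ 223 ∷ 229 ∷ 231 ∷ 233 ∷ 235 ∷ 237 ∷ 239 ∷ 243 ∷ 245 ∷ 247 ∷ 249 ∷
  251 ∷ 253 ∷ 255 ∷ 293 ∷ 295 ∷ 299 ∷ 301 ∷ 303 ∷ 307 ∷ 309 ∷ 311 ∷ 315 ∷
  317 ∷ 319 ∷ 331 ∷ 333 ∷ 335 ∷ 339 ∷ 343 ∷ 347 ∷ 349 ∷ 351 ∷ 359 ∷ 363 ∷
  365 ∷ 367 ∷ 371 ∷ 373 ∷ 375 ∷ 379 ∷ 381 ∷ 383 ∷ 411 ∷ 413 ∷ 415 ∷ 423 ∷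
  427 ∷ 429 ∷ 431 ∷ 437 ∷ 439 ∷ 443 ∷ 445 ∷ 447 ∷ 463 ∷ 469 ∷ 471 ∷ 475 ∷
  477 ∷ 479 ∷ 491 ∷ 493 ∷ 495 ∷ 501 ∷ 503 ∷ 507 ∷ 509 ∷ 511 ∷ 695 ∷ 699 ∷
  727 ∷ 731 ∷ 735 ∷ 751 ∷ 759 ∷ 763 ∷ 879 ∷ 887 ∷ 895 ∷ 959 ∷ 991 ∷ []

closedWalkCover : List (List (Word 10))
closedWalkCover = map (map word) shortWalks ++ map (necklace ∘ word) necklaceRepresentatives

independentSet-independent : IsIndependent independentSet
independentSet-independent = independent-if-successors-loop
  (allNew⇒unique (empty 11) independentSet (from-yes (allNew? (empty 11) independentSet)))
  (successorsLoopOrOutside⇒loop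
    (from-yes (all? (successorsLoopOrOutside? (fromList independentSet)) independentSet)))

ones∉independentSet : ones 10 ∉ independentSet
ones∉independentSet = from-no (ones 10 ∈? independentSet)
  where open DecMembership _≟_ using (_∈?_)

closedWalkCover-closed : All (ClosedWalk Adjacent) closedWalkCover
closedWalkCover-closed = from-yes (all? (closedWalk? adjacent?) closedWalkCover)

closedWalkCover-complete : ∀ w → w ∈ concat closedWalkCover
closedWalkCover-complete = fromList-isFull⇒complete (concat closedWalkCover) tt

closedWalkCover-bound : sum (map (⌊_/2⌋ ∘ length) closedWalkCover) ≡ 931
closedWalkCover-bound = refl

theorem4p7 : (Σ (List (Word 10)) λ S → IsIndependent S × length S ≡ 931 × zeros 10 ∈ S × ones 10 ∉ S)
    × (∀ (S : List (Word 10)) → IsIndependent S → length S ≤ 931)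
theorem4p7 =
  (independentSet , independentSet-independent , refl , here refl , ones∉independentSet) ,
  λ S (unique , independent) → ≤-trans
    (independent-≤-closedWalkCover _≟_ closedWalkCover unique independent
      closedWalkCover-closed (λ {w} _ → closedWalkCover-complete w))
    (≤-reflexive closedWalkCover-bound)
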